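{- Let $T\subseteq X_0$ be a generalised nice set such that $T\cap X\neq\emptyset$ and $T\setminus X\neq\emptyset$. Then $T\setminus X$ is a generalised nice set if and only if $T\cap X$ is a generalised nice set.
   Context: Let $I=\{1,\dots,7\}$ and $I_0=I\cup\{0\}$. The Fano plane on $I$ has the seven lines $\{1,2,5\},\{5,6,7\},\{1,4,7\},\{1,3,6\},\{2,4,6\},\{2,3,7\},\{3,4,5\}$. For distinct $i,j\in I$, $i*j$ is the third point of the unique line containing $i$ and $j$. The operation is extended to $I_0$ by $0*i=i*0=i$ and $i*i=0$ for all $i\in I_0$. Let $X_0$ be the set of unordered pairs $\{i,j\}$ with $i,j\in I_0$, where $i=j$ is allowed, and $X=\{\{i,j\}:i,j\in I,\ i\neq j\}$. For $i,j,k\in I_0$ let $P_{\{i,j,k\}}=\{\{i,j\},\{j,k\},\{k,i\},\{i,j*k\},\{j,k*i\},\{k,i*j\}\}\subseteq X_0$. A subset $T\subseteq X_0$ is a generalised nice set if for all $i,j,k\in I_0$, $\{i,j\}\in T$ and $\{i*j,k\}\in T$ imply $P_{\{i,j,k\}}\subseteq T$. -}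

module Defs where

open import Data.Nat using (ℕ)
open import Data.Fin using (Fin; zero; suc; _≤_; _≤?_; #_)
open import Data.Fin.Properties using (≤-total)
open import Data.Sum using (inj₁; inj₂)
open import Data.Vec using (Vec; lookup; _∷_; [])
open import Data.Product using (Σ; _×_; _,_; ∃-syntax)
open import Relation.Nullary using (¬_; yes; no)
open import Relation.Binary.PropositionalEquality using (_≡_)

I₀ : Set
I₀ = Fin 8

-- Multiplication table of * on I₀ (Fano plane lines {1,2,5},{5,6,7},
-- {1,4,7},{1,3,6},{2,4,6},{2,3,7},{3,4,5}; 0*i = i*0 = i; i*i = 0).
table : Vec (Vec ℕ 8) 8
table =
  (0 ∷ 1 ∷ 2 ∷ 3 ∷ 4 ∷ 5 ∷ 6 ∷ 7 ∷ []) ∷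
  (1 ∷ 0 ∷ 5 ∷ 6 ∷ 7 ∷ 2 ∷ 3 ∷ 4 ∷ []) ∷
  (2 ∷ 5 ∷ 0 ∷ 7 ∷ 6 ∷ 1 ∷ 4 ∷ 3 ∷ []) ∷
  (3 ∷ 6 ∷ 7 ∷ 0 ∷ 5 ∷ 4 ∷ 1 ∷ 2 ∷ []) ∷
  (4 ∷ 7 ∷ 6 ∷ 5 ∷ 0 ∷ 3 ∷ 2 ∷ 1 ∷ []) ∷
  (5 ∷ 2 ∷ 1 ∷ 4 ∷ 3 ∷ 0 ∷ 7 ∷ 6 ∷ []) ∷
  (6 ∷ 3 ∷ 4 ∷ 1 ∷ 2 ∷ 7 ∷ 0 ∷ 5 ∷ []) ∷
  (7 ∷ 4 ∷ 3 ∷ 2 ∷ 1 ∷ 6 ∷ 5 ∷ 0 ∷ []) ∷ []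

toFin8 : ℕ → Fin 8
toFin8 0 = # 0
toFin8 1 = # 1
toFin8 2 = # 2
toFin8 3 = # 3
toFin8 4 = # 4
toFin8 5 = # 5
toFin8 6 = # 6
toFin8 _ = # 7

infixl 7 _*_
_*_ : I₀ → I₀ → I₀
i * j = toFin8 (lookup (lookup table i) j)

-- Unordered pairs {i,j} of elements of I₀ (i = j allowed), stored in
-- normal form i ≤ j.  X₀ is this type.
X₀ : Set
X₀ = Σ I₀ λ i → Σ I₀ λ j → i ≤ j

pair : I₀ → I₀ → X₀
pair i j with ≤-total i j
... | inj₁ p = i , j , p
... | inj₂ q = j , i , q

SubsetX₀ : Set₁
SubsetX₀ = X₀ → Set

-- X = {{i,j} : i,j ∈ I, i ≠ j}: both entries nonzero and distinct.
InX : X₀ → Set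
InX (i , j , _) = ¬ (i ≡ zero) × ¬ (j ≡ zero) × ¬ (i ≡ j)

P⊆ : I₀ → I₀ → I₀ → SubsetX₀ → Set
P⊆ i j k T =
  T (pair i j) × T (pair j k) × T (pair k i) ×
  T (pair i (j * k)) × T (pair j (k * i)) × T (pair k (i * j))

GenNice : SubsetX₀ → Set
GenNice T = ∀ (i j k : I₀) → T (pair i j) → T (pair (i * j) k) → P⊆ i j k T

_∩X : SubsetX₀ → SubsetX₀
(T ∩X) p = T p × InX p

_∖X : SubsetX₀ → SubsetX₀
(T ∖X) p = T p × ¬ InX p

NonEmpty : SubsetX₀ → Set
NonEmpty T = ∃[ p ] T p

{-# OPTIONS --safe #-}
-- Since T is nice, both defining pairs lying in T puts all of P_{i,j,k} in T,
-- so it only remains to see that P_{i,j,k} stays inside X (resp. outside X).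
-- An exhaustive check over I₀³ shows that this can fail only when k ∈ {i,j}
-- (resp. when i = j and {i,k} ∈ X).  In either exceptional case T contains an
-- X-pair {i,j} together with {i*j,i}.  That is impossible when T ∖ X is nice,
-- since T and T ∖ X then push {i,j} out of X, and impossible when T ∩ X is
-- nice, since T ∩ X then contains the diagonal pair {i,i}.

module Submission where

open import Defs
open import Data.Product using (_×_; _,_)
open import Function.Bundles using (_⇔_; mk⇔)
open import Data.Fin using (zero; _≟_)
open import Data.Fin.Properties using (≤-total; ≤-antisym; ≤-irrelevant; all?)
open import Data.Sum using (_⊎_; inj₁; inj₂)
open import Data.Empty using (⊥-elim)
open import Relation.Nullary using (¬_; Dec)
open import Relation.Nullary.Decidable using (¬?; _×-dec_; _⊎-dec_; _→-dec_; from-yes)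
open import Relation.Binary.PropositionalEquality using (_≡_; refl; cong; subst)

pair-comm : ∀ a b → pair a b ≡ pair b a
pair-comm a b with ≤-total a b | ≤-total b a
... | inj₁ p | inj₁ q with refl ← ≤-antisym p q = cong (λ r → a , a , r) (≤-irrelevant p q)
... | inj₁ p | inj₂ q = cong (λ r → a , b , r) (≤-irrelevant p q)
... | inj₂ p | inj₁ q = cong (λ r → b , a , r) (≤-irrelevant p q)
... | inj₂ p | inj₂ q with refl ← ≤-antisym p q = cong (λ r → a , a , r) (≤-irrelevant p q)

InX? : ∀ p → Dec (InX p)
InX? (i , j , _) = ¬? (i ≟ zero) ×-dec ¬? (j ≟ zero) ×-dec ¬? (i ≟ j)

P⊆? : {T : SubsetX₀} → (∀ p → Dec (T p)) → ∀ i j k → Dec (P⊆ i j k T)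
P⊆? T? i j k =
  T? (pair i j) ×-dec T? (pair j k) ×-dec T? (pair k i) ×-dec
  T? (pair i (j * k)) ×-dec T? (pair j (k * i)) ×-dec T? (pair k (i * j))

P⊆-× : ∀ {A B : SubsetX₀} i j k → P⊆ i j k A → P⊆ i j k B →
       P⊆ i j k (λ p → A p × B p)
P⊆-× _ _ _ (a₁ , a₂ , a₃ , a₄ , a₅ , a₆) (b₁ , b₂ , b₃ , b₄ , b₅ , b₆) =
  (a₁ , b₁) , (a₂ , b₂) , (a₃ , b₃) , (a₄ , b₄) , (a₅ , b₅) , (a₆ , b₆)

-- Opaque: unfolding these exhaustive checks during type checking is prohibitively slow.
opaque
  *-comm : ∀ i j → i * j ≡ j * i
  *-comm = from-yes (all? λ i → all? λ j → i * j ≟ j * i)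

  ¬InX-pair-diag : ∀ i → ¬ InX (pair i i)
  ¬InX-pair-diag = from-yes (all? λ i → ¬? (InX? (pair i i)))

  ¬InX-pair-i*i : ∀ i j → ¬ InX (pair (i * i) j)
  ¬InX-pair-i*i = from-yes (all? λ i → all? λ j → ¬? (InX? (pair (i * i) j)))

  InX-pair-*ˡ : ∀ i j → InX (pair i j) → InX (pair (i * j) i)
  InX-pair-*ˡ =
    from-yes (all? λ i → all? λ j → InX? (pair i j) →-dec InX? (pair (i * j) i))

  P⊆InX-or-repeat : ∀ i j k → InX (pair i j) → InX (pair (i * j) k) →
                    P⊆ i j k InX ⊎ (k ≡ i ⊎ k ≡ j)
  P⊆InX-or-repeat = from-yes (all? λ i → all? λ j → all? λ k →
    InX? (pair i j) →-dec InX? (pair (i * j) k) →-dec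
    (P⊆? InX? i j k ⊎-dec ((k ≟ i) ⊎-dec (k ≟ j))))

  P⊆∁X-or-diag : ∀ i j k → ¬ InX (pair i j) → ¬ InX (pair (i * j) k) →
                 P⊆ i j k (λ p → ¬ InX p) ⊎ (i ≡ j × InX (pair i k))
  P⊆∁X-or-diag = from-yes (all? λ i → all? λ j → all? λ k →
    ¬? (InX? (pair i j)) →-dec ¬? (InX? (pair (i * j) k)) →-dec
    (P⊆? (λ p → ¬? (InX? p)) i j k ⊎-dec ((i ≟ j) ×-dec InX? (pair i k))))

module _ {T : SubsetX₀} where

  ∩X-nice⇒∉-pair-*ˡ : GenNice (T ∩X) → ∀ i j → InX (pair i j) → T (pair i j) →
                      ¬ T (pair (i * j) i)
  ∩X-nice⇒∉-pair-*ˡ niceX i j x t t′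
    with _ , _ , (_ , xᵢᵢ) , _ ← niceX i j i (t , x) (t′ , InX-pair-*ˡ i j x)
    = ¬InX-pair-diag i xᵢᵢ

  ∖X-nice⇒∉-pair-*ˡ : GenNice T → GenNice (T ∖X) → ∀ i j → InX (pair i j) →
                      T (pair i j) → ¬ T (pair (i * j) i)
  ∖X-nice⇒∉-pair-*ˡ nice niceᶜ i j x t t′
    with _ , _ , tᵢᵢ , _ , tⱼᵢᵢ , _ ← nice i j i t t′
    with _ , (_ , ¬xᵢⱼ) , _ ←
           niceᶜ i i j (tᵢᵢ , ¬InX-pair-diag i)
                       (subst T (pair-comm j (i * i)) tⱼᵢᵢ , ¬InX-pair-i*i i j)
    = ¬xᵢⱼ x

  ∖X-nice⇒∩X-nice : GenNice T → GenNice (T ∖X) → GenNice (T ∩X)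
  ∖X-nice⇒∩X-nice nice niceᶜ i j k (tᵢⱼ , xᵢⱼ) (t , x) =
    P⊆-× {T} {InX} i j k (nice i j k tᵢⱼ t) inX
    where
    inX : P⊆ i j k InX
    inX with P⊆InX-or-repeat i j k xᵢⱼ x
    ... | inj₁ p = p
    ... | inj₂ (inj₁ refl) = ⊥-elim (∖X-nice⇒∉-pair-*ˡ nice niceᶜ i j xᵢⱼ tᵢⱼ t)
    ... | inj₂ (inj₂ refl) =
      ⊥-elim (∖X-nice⇒∉-pair-*ˡ nice niceᶜ j i
                (subst InX (pair-comm i j) xᵢⱼ)
                (subst T (pair-comm i j) tᵢⱼ)
                (subst (λ a → T (pair a j)) (*-comm i j) t))

  ∩X-nice⇒∖X-nice : GenNice T → GenNice (T ∩X) → GenNice (T ∖X)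
  ∩X-nice⇒∖X-nice nice niceX i j k (tᵢⱼ , ¬xᵢⱼ) (t , ¬x) =
    P⊆-× {T} {λ p → ¬ InX p} i j k (nice i j k tᵢⱼ t) outX
    where
    outX : P⊆ i j k (λ p → ¬ InX p)
    outX with P⊆∁X-or-diag i j k ¬xᵢⱼ ¬x
    ... | inj₁ p = p
    ... | inj₂ (refl , xᵢₖ) with _ , _ , tₖᵢ , tᵢᵢₖ , _ ← nice i i k tᵢⱼ t =
      ⊥-elim (∩X-nice⇒∉-pair-*ˡ niceX i k xᵢₖ
                (subst T (pair-comm k i) tₖᵢ)
                (subst T (pair-comm i (i * k)) tᵢᵢₖ))

corollary2p9 : (T : SubsetX₀) → GenNice T → NonEmpty (T ∩X) → NonEmpty (T ∖X)
    → (GenNice (T ∖X) ⇔ GenNice (T ∩X))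
corollary2p9 T nice _ _ = mk⇔ (∖X-nice⇒∩X-nice {T} nice) (∩X-nice⇒∖X-nice {T} nice)
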